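{- Any binary Boolean VCSP instance $\mathcal{C}'$ can be transformed into a simple binary Boolean VCSP instance $\mathcal{C}$ that is magnitude-equivalent to $\mathcal{C}'$ and satisfies $\mathrm{span}(\mathcal{C})\le 4\,\mathrm{span}(\mathcal{C}')$.
   Context: Variables are indexed by $[n]$, each with domain $\{0,1\}$. A (valued) constraint with scope $S\subseteq[n]$ is a function $C_S:\{0,1\}^S\to\mathbb{Z}$ (scope $\emptyset$ gives a constant). A binary Boolean VCSP instance is a finite set of constraints with scopes of size at most $2$, at most one per scope; it implements $f(x)=\sum_{C_S\in\mathcal{C}}C_S(x[S])$. Two instances are magnitude-equivalent if they implement the same fitness function. The span is $\mathrm{span}(\mathcal{C})=\sum_{C_S\in\mathcal{C}}(\max_z C_S(z)-\min_z C_S(z))$. An instance is simple if every unary constraint satisfies $C_i(0)=0,C_i(1)=c_i$ and every binary constraint satisfies $C_{ij}(0,0)=C_{ij}(0,1)=C_{ij}(1,0)=0$, $C_{ij}(1,1)=c_{ij}$ (a constant constraint is allowed). -}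

module Defs where

open import Data.Bool using (Bool; true; false)
open import Data.Fin using (Fin; zero; suc; toℕ)
open import Data.Nat as ℕ using (ℕ)
import Data.Nat.Properties as ℕP
open import Data.Integer using (ℤ; _+_; _-_; _⊔_; _⊓_; 0ℤ)
open import Data.Maybe using (Maybe; just; nothing)
open import Data.Unit using (⊤)
open import Data.Product using (_×_)
open import Relation.Binary.PropositionalEquality using (_≡_)
open import Relation.Nullary using (yes; no)

-- Assignments: x : Fin n → Bool, with false = 0 and true = 1.
Assignment : ℕ → Set
Assignment n = Fin n → Bool

-- Scopes are subsets of size ≤ 2; at most one constraint per scope, so an
-- instance assigns to each scope either nothing or one constraint.
--   * scope ∅        : an optional constant
--   * scope {i}      : an optional unary constraint Bool → ℤ
--   * scope {i , j}  : indexed by i < j (as naturals); an optional binary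
--                      constraint Bool → Bool → ℤ, with arguments (x i , x j).
record Instance (n : ℕ) : Set where
  field
    const  : Maybe ℤ
    unary  : Fin n → Maybe (Bool → ℤ)
    binary : (i j : Fin n) → toℕ i ℕ.< toℕ j → Maybe (Bool → Bool → ℤ)
open Instance public

sumFin : (n : ℕ) → (Fin n → ℤ) → ℤ
sumFin ℕ.zero    f = 0ℤ
sumFin (ℕ.suc n) f = f zero + sumFin n (λ i → f (suc i))

opt : {A : Set} → (A → ℤ) → Maybe A → ℤ
opt g nothing  = 0ℤ
opt g (just a) = g a

sumPairs : (n : ℕ) → ((i j : Fin n) → toℕ i ℕ.< toℕ j → ℤ) → ℤ
sumPairs n g = sumFin n (λ i → sumFin n (λ j → h i j))
  where
  h : Fin n → Fin n → ℤ
  h i j with toℕ i ℕ.<? toℕ j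
  ... | yes p = g i j p
  ... | no _  = 0ℤ

eval : {n : ℕ} → Instance n → Assignment n → ℤ
eval {n} C x =
  opt (λ c → c) (const C)
  + sumFin n (λ i → opt (λ u → u (x i)) (unary C i))
  + sumPairs n (λ i j p → opt (λ b → b (x i) (x j)) (binary C i j p))

MagnitudeEquivalent : {n : ℕ} → Instance n → Instance n → Set
MagnitudeEquivalent C D = ∀ x → eval C x ≡ eval D x

range0 : ℤ → ℤ
range0 c = c - c

range1 : (Bool → ℤ) → ℤ
range1 u = (u false ⊔ u true) - (u false ⊓ u true)

range2 : (Bool → Bool → ℤ) → ℤ
range2 b = ((b false false ⊔ b false true) ⊔ (b true false ⊔ b true true))
         - ((b false false ⊓ b false true) ⊓ (b true false ⊓ b true true))

span : {n : ℕ} → Instance n → ℤ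
span {n} C =
  opt range0 (const C)
  + sumFin n (λ i → opt range1 (unary C i))
  + sumPairs n (λ i j p → opt range2 (binary C i j p))

SimpleUnary : Maybe (Bool → ℤ) → Set
SimpleUnary nothing  = ⊤
SimpleUnary (just u) = u false ≡ 0ℤ

SimpleBinary : Maybe (Bool → Bool → ℤ) → Set
SimpleBinary nothing  = ⊤
SimpleBinary (just b) = b false false ≡ 0ℤ × b false true ≡ 0ℤ × b true false ≡ 0ℤ

record Simple {n : ℕ} (C : Instance n) : Set where
  field
    unary-simple  : ∀ i → SimpleUnary (unary C i)
    binary-simple : ∀ i j (p : toℕ i ℕ.< toℕ j) → SimpleBinary (binary C i j p)

-- Write every unary constraint as u(z) = u(0) + z·(u(1) − u(0)) and every binary one as
-- b(z,w) = b(0,0) + z·(b(1,0) − b(0,0)) + w·(b(0,1) − b(0,0)) + zw·q with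
-- q = b(1,1) − b(1,0) − b(0,1) + b(0,0). Collecting the constants into the constant
-- constraint, each linear coefficient into the unary constraint of its variable and each
-- q into a simple binary constraint gives a simple instance with the same fitness function.
-- Every linear coefficient of a binary constraint is at most its span in absolute value
-- and |q| at most twice it, so the new unary constraints cost at most
-- span(unaries) + 2·span(binaries), the new binary ones at most 2·span(binaries).
module Submission where

open import Defs
open import Data.Bool using (Bool; true; false; _∧_)
open import Data.Fin using (Fin; zero; suc; toℕ)
open import Data.Integer using (ℤ; 0ℤ; +_; -_; _+_; _-_; _*_; _⊔_; _⊓_; _≤_)
import Data.Integer.Properties as ℤP
open import Data.Integer.Tactic.RingSolver using (solve-∀)
open import Data.Maybe as Maybe using (Maybe; just; nothing)
open import Data.Nat as ℕ using (ℕ)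
open import Data.Product using (Σ; _×_; _,_)
open import Data.Sum using (inj₁; inj₂)
open import Data.Unit using (tt)
open import Relation.Binary.PropositionalEquality
open import Relation.Nullary using (Dec; yes; no)

record Additive (R : ℤ → ℤ → Set) : Set where
  field
    0-closed : R 0ℤ 0ℤ
    +-closed : ∀ {a b c d} → R a b → R c d → R (a + c) (b + d)
open Additive

≡-additive : Additive _≡_
≡-additive = record { 0-closed = refl ; +-closed = cong₂ _+_ }

≤-additive : Additive _≤_
≤-additive = record { 0-closed = ℤP.≤-refl ; +-closed = ℤP.+-mono-≤ }

sumFin-preserves : ∀ {R} → Additive R → ∀ n {f g : Fin n → ℤ} →
  (∀ i → R (f i) (g i)) → R (sumFin n f) (sumFin n g)
sumFin-preserves A ℕ.zero    e = 0-closed A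
sumFin-preserves A (ℕ.suc n) e = +-closed A (e zero) (sumFin-preserves A n (λ i → e (suc i)))

sumFin-cong : ∀ n {f g : Fin n → ℤ} → (∀ i → f i ≡ g i) → sumFin n f ≡ sumFin n g
sumFin-cong = sumFin-preserves ≡-additive

sumFin-zero : ∀ n → sumFin n (λ _ → 0ℤ) ≡ 0ℤ
sumFin-zero ℕ.zero    = refl
sumFin-zero (ℕ.suc n) = trans (ℤP.+-identityˡ _) (sumFin-zero n)

sumFin-+ : ∀ n (f g : Fin n → ℤ) → sumFin n (λ i → f i + g i) ≡ sumFin n f + sumFin n g
sumFin-+ ℕ.zero    f g = refl
sumFin-+ (ℕ.suc n) f g =
  trans (cong (_+_ (f zero + g zero)) (sumFin-+ n (λ i → f (suc i)) (λ i → g (suc i))))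
        (+-interchange (f zero) (g zero) _ _)
  where
  +-interchange : ∀ a b c d → (a + b) + (c + d) ≡ (a + c) + (b + d)
  +-interchange = solve-∀

sumFin-comm : ∀ n m (g : Fin n → Fin m → ℤ) →
  sumFin n (λ i → sumFin m (g i)) ≡ sumFin m (λ j → sumFin n (λ i → g i j))
sumFin-comm ℕ.zero    m g = sym (sumFin-zero m)
sumFin-comm (ℕ.suc n) m g =
  trans (cong (_+_ (sumFin m (g zero))) (sumFin-comm n m (λ i → g (suc i))))
        (sym (sumFin-+ m (g zero) (λ j → sumFin n (λ i → g (suc i) j))))

sumFin-nonneg : ∀ n {f : Fin n → ℤ} → (∀ i → 0ℤ ≤ f i) → 0ℤ ≤ sumFin n f
sumFin-nonneg ℕ.zero    e = ℤP.≤-refl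
sumFin-nonneg (ℕ.suc n) e = ℤP.+-mono-≤ (e zero) (sumFin-nonneg n (λ i → e (suc i)))

single : ∀ {n} → Fin n → ℤ → Fin n → ℤ
single zero    v zero    = v
single zero    v (suc i) = 0ℤ
single (suc k) v zero    = 0ℤ
single (suc k) v (suc i) = single k v i

single-preserves : ∀ {R} → Additive R → ∀ {n} (k i : Fin n) {v w} →
  R v w → R (single k v i) (single k w i)
single-preserves A zero    zero    r = r
single-preserves A zero    (suc i) r = 0-closed A
single-preserves A (suc k) zero    r = 0-closed A
single-preserves A (suc k) (suc i) r = single-preserves A k i r

sumFin-single : ∀ n (k : Fin n) v → sumFin n (single k v) ≡ v
sumFin-single (ℕ.suc n) zero    v = trans (cong (_+_ v) (sumFin-zero n)) (ℤP.+-identityʳ v)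
sumFin-single (ℕ.suc n) (suc k) v = trans (ℤP.+-identityˡ _) (sumFin-single n k v)

PairFn : ℕ → Set
PairFn n = (i j : Fin n) → toℕ i ℕ.< toℕ j → ℤ

onYes : {P : Set} → Dec P → (P → ℤ) → ℤ
onYes (yes p) f = f p
onYes (no _)  f = 0ℤ

onYes-preserves : ∀ {R} → Additive R → {P : Set} (d : Dec P) {f g : P → ℤ} →
  (∀ p → R (f p) (g p)) → R (onYes d f) (onYes d g)
onYes-preserves A (yes p) e = e p
onYes-preserves A (no _)  e = 0-closed A

onYes-sumFin : ∀ n {P : Set} (d : Dec P) (f : Fin n → P → ℤ) →
  sumFin n (λ i → onYes d (f i)) ≡ onYes d (λ p → sumFin n (λ i → f i p))
onYes-sumFin n (yes p) f = refl
onYes-sumFin n (no _)  f = sumFin-zero n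

sumPairs-entry : ∀ {n} (g : PairFn n) i j → _ ≡ onYes (toℕ i ℕ.<? toℕ j) (g i j)

-- The left side of sumPairs-entry is the with-defined summand of sumPairs, which cannot be
-- named here; its type is fixed by this use, and the definition follows.
sumPairs-as-sumFin : ∀ n (g : PairFn n) →
  sumPairs n g ≡ sumFin n (λ i → sumFin n (λ j → onYes (toℕ i ℕ.<? toℕ j) (g i j)))
sumPairs-as-sumFin n g = sumFin-cong n λ i → sumFin-cong n λ j → sumPairs-entry g i j

sumPairs-entry g i j with toℕ i ℕ.<? toℕ j
... | yes p = refl
... | no _  = refl

sumPairs-preserves : ∀ {R} → Additive R → ∀ n {f g : PairFn n} →
  (∀ i j p → R (f i j p) (g i j p)) → R (sumPairs n f) (sumPairs n g)
sumPairs-preserves {R} A n {f} {g} e =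
  subst₂ R (sym (sumPairs-as-sumFin n f)) (sym (sumPairs-as-sumFin n g))
    (sumFin-preserves A n λ i → sumFin-preserves A n λ j →
      onYes-preserves A (toℕ i ℕ.<? toℕ j) (e i j))

sumPairs-cong : ∀ n {f g : PairFn n} → (∀ i j p → f i j p ≡ g i j p) →
  sumPairs n f ≡ sumPairs n g
sumPairs-cong = sumPairs-preserves ≡-additive

sumPairs-zero : ∀ n → sumPairs n (λ _ _ _ → 0ℤ) ≡ 0ℤ
sumPairs-zero n = trans (sumPairs-as-sumFin n _)
  (trans (sumFin-cong n λ i → trans (sumFin-cong n λ j → onYes-zero (toℕ i ℕ.<? toℕ j))
                                    (sumFin-zero n))
         (sumFin-zero n))
  where
  onYes-zero : {P : Set} (d : Dec P) → onYes d (λ _ → 0ℤ) ≡ 0ℤ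
  onYes-zero (yes p) = refl
  onYes-zero (no _)  = refl

sumPairs-+ : ∀ n (f g : PairFn n) →
  sumPairs n (λ i j p → f i j p + g i j p) ≡ sumPairs n f + sumPairs n g
sumPairs-+ n f g = begin
  sumPairs n (λ i j p → f i j p + g i j p)
    ≡⟨ sumPairs-as-sumFin n _ ⟩
  sumFin n (λ i → sumFin n (λ j → onYes (toℕ i ℕ.<? toℕ j) (λ p → f i j p + g i j p)))
    ≡⟨ sumFin-cong n (λ i → trans (sumFin-cong n (λ j → onYes-+ (toℕ i ℕ.<? toℕ j) (f i j) (g i j)))
                                  (sumFin-+ n _ _)) ⟩
  sumFin n (λ i → sumFin n (λ j → onYes (toℕ i ℕ.<? toℕ j) (f i j))
                + sumFin n (λ j → onYes (toℕ i ℕ.<? toℕ j) (g i j)))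
    ≡⟨ sumFin-+ n _ _ ⟩
  sumFin n (λ i → sumFin n (λ j → onYes (toℕ i ℕ.<? toℕ j) (f i j)))
    + sumFin n (λ i → sumFin n (λ j → onYes (toℕ i ℕ.<? toℕ j) (g i j)))
    ≡⟨ sym (cong₂ _+_ (sumPairs-as-sumFin n f) (sumPairs-as-sumFin n g)) ⟩
  sumPairs n f + sumPairs n g ∎
  where
  open ≡-Reasoning
  onYes-+ : {P : Set} (d : Dec P) (f g : P → ℤ) → onYes d (λ p → f p + g p) ≡ onYes d f + onYes d g
  onYes-+ (yes p) f g = refl
  onYes-+ (no _)  f g = refl

sumFin-sumPairs-comm : ∀ n m (g : Fin n → PairFn m) →
  sumFin n (λ i → sumPairs m (g i)) ≡ sumPairs m (λ k l p → sumFin n (λ i → g i k l p))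
sumFin-sumPairs-comm n m g =
  trans (sumFin-cong n (λ i → sumPairs-as-sumFin m (g i)))
  (trans (trans (sumFin-comm n m _) (sumFin-cong m (λ k → sumFin-comm n m _)))
  (trans (sumFin-cong m λ k → sumFin-cong m λ l → onYes-sumFin n (toℕ k ℕ.<? toℕ l) (λ i → g i k l))
         (sym (sumPairs-as-sumFin m _))))

opt-preserves : ∀ {R} → Additive R → {A : Set} {f g : A → ℤ} →
  (∀ a → R (f a) (g a)) → (m : Maybe A) → R (opt f m) (opt g m)
opt-preserves A e nothing  = 0-closed A
opt-preserves A e (just a) = e a

opt-cong : {A : Set} {f g : A → ℤ} → (∀ a → f a ≡ g a) → (m : Maybe A) → opt f m ≡ opt g m
opt-cong = opt-preserves ≡-additive

opt-+ : {A : Set} (f g : A → ℤ) (m : Maybe A) → opt (λ a → f a + g a) m ≡ opt f m + opt g m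
opt-+ f g nothing  = refl
opt-+ f g (just a) = refl

sumFin-opt : ∀ n {A : Set} (f : Fin n → A → ℤ) (m : Maybe A) →
  sumFin n (λ i → opt (f i) m) ≡ opt (λ a → sumFin n (λ i → f i a)) m
sumFin-opt n f nothing  = sumFin-zero n
sumFin-opt n f (just a) = refl

opt-map : {A B : Set} (g : B → ℤ) (f : A → B) (m : Maybe A) →
  opt g (Maybe.map f m) ≡ opt (λ a → g (f a)) m
opt-map g f nothing  = refl
opt-map g f (just a) = refl

sumFin-endpoints : ∀ n {A : Set} (B : (k l : Fin n) → toℕ k ℕ.< toℕ l → Maybe A)
  (f g : (k l : Fin n) → toℕ k ℕ.< toℕ l → A → ℤ) →
  sumFin n (λ i → sumPairs n (λ k l p →
    opt (λ b → single k (f k l p b) i + single l (g k l p b) i) (B k l p)))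
  ≡ sumPairs n (λ k l p → opt (λ b → f k l p b + g k l p b) (B k l p))
sumFin-endpoints n B f g = trans (sumFin-sumPairs-comm n n _)
  (sumPairs-cong n λ k l p → trans (sumFin-opt n _ (B k l p))
    (opt-cong (λ b → trans (sumFin-+ n _ _)
                           (cong₂ _+_ (sumFin-single n k _) (sumFin-single n l _)))
              (B k l p)))

infixl 7 _·_
_·_ : Bool → ℤ → ℤ
false · a = 0ℤ
true  · a = a

·-zeroʳ : ∀ z → z · 0ℤ ≡ 0ℤ
·-zeroʳ false = refl
·-zeroʳ true  = refl

·-distrib-+ : ∀ z a b → z · (a + b) ≡ z · a + z · b
·-distrib-+ false a b = refl
·-distrib-+ true  a b = refl

·-opt : ∀ z {A : Set} (f : A → ℤ) (m : Maybe A) → z · opt f m ≡ opt (λ a → z · f a) m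
·-opt z f nothing  = ·-zeroʳ z
·-opt z f (just a) = refl

·-sumPairs : ∀ z n (g : PairFn n) → z · sumPairs n g ≡ sumPairs n (λ k l p → z · g k l p)
·-sumPairs false n g = sym (sumPairs-zero n)
·-sumPairs true  n g = refl

·-single : ∀ {n} (x : Fin n → Bool) k i v → x i · single k v i ≡ single k (x k · v) i
·-single x zero    zero    v = refl
·-single x zero    (suc i) v = ·-zeroʳ (x (suc i))
·-single x (suc k) zero    v = ·-zeroʳ (x zero)
·-single x (suc k) (suc i) v = ·-single (λ j → x (suc j)) k i v

infix 4 ∣_∣≤_
∣_∣≤_ : ℤ → ℤ → Set
∣ a ∣≤ r = a ≤ r × - a ≤ r

∣∣≤-additive : Additive ∣_∣≤_
∣∣≤-additive = record
  { 0-closed = ℤP.≤-refl , ℤP.≤-refl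
  ; +-closed = λ {a} {r} {b} {s} (p , p′) (q , q′) →
      ℤP.+-mono-≤ p q , subst (_≤ r + s) (sym (ℤP.neg-distrib-+ a b)) (ℤP.+-mono-≤ p′ q′)
  }

∣-∣≤-width : ∀ {m a b M} → m ≤ a → a ≤ M → m ≤ b → b ≤ M → ∣ a - b ∣≤ M - m
∣-∣≤-width {m} {a} {b} {M} m≤a a≤M m≤b b≤M =
  ℤP.+-mono-≤ a≤M (ℤP.neg-mono-≤ m≤b) ,
  subst (_≤ M - m) (sym (neg-diff a b)) (ℤP.+-mono-≤ b≤M (ℤP.neg-mono-≤ m≤a))
  where
  neg-diff : ∀ a b → - (a - b) ≡ b - a
  neg-diff = solve-∀

-- The span of a simple constraint with value a in its one non-zero entry.
spread : ℤ → ℤ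
spread a = (0ℤ ⊔ a) - (0ℤ ⊓ a)

spread-≤ : ∀ {a r} → ∣ a ∣≤ r → spread a ≤ r
spread-≤ {a} {r} (p , p′) with ℤP.≤-total 0ℤ a
... | inj₁ q rewrite ℤP.i≤j⇒i⊔j≡j q | ℤP.i≤j⇒i⊓j≡i q = subst (_≤ r) (sym (ℤP.+-identityʳ a)) p
... | inj₂ q rewrite ℤP.i≥j⇒i⊔j≡i q | ℤP.i≥j⇒i⊓j≡j q = subst (_≤ r) (sym (ℤP.+-identityˡ (- a))) p′

max₁ min₁ : (Bool → ℤ) → ℤ
max₁ u = u false ⊔ u true
min₁ u = u false ⊓ u true

max₂ min₂ : (Bool → Bool → ℤ) → ℤ
max₂ b = (b false false ⊔ b false true) ⊔ (b true false ⊔ b true true)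
min₂ b = (b false false ⊓ b false true) ⊓ (b true false ⊓ b true true)

≤max₁ : ∀ u z → u z ≤ max₁ u
≤max₁ u false = ℤP.i≤i⊔j (u false) (u true)
≤max₁ u true  = ℤP.i≤j⊔i (u false) (u true)

min₁≤ : ∀ u z → min₁ u ≤ u z
min₁≤ u false = ℤP.i⊓j≤i (u false) (u true)
min₁≤ u true  = ℤP.i⊓j≤j (u false) (u true)

≤max₂ : ∀ b z w → b z w ≤ max₂ b
≤max₂ b false false = ℤP.i≤j⇒i≤j⊔k _ (ℤP.i≤i⊔j (b false false) (b false true))
≤max₂ b false true  = ℤP.i≤j⇒i≤j⊔k _ (ℤP.i≤j⊔i (b false false) (b false true))
≤max₂ b true  false = ℤP.i≤j⇒i≤k⊔j _ (ℤP.i≤i⊔j (b true false) (b true true))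
≤max₂ b true  true  = ℤP.i≤j⇒i≤k⊔j _ (ℤP.i≤j⊔i (b true false) (b true true))

min₂≤ : ∀ b z w → min₂ b ≤ b z w
min₂≤ b false false = ℤP.i≤j⇒i⊓k≤j _ (ℤP.i⊓j≤i (b false false) (b false true))
min₂≤ b false true  = ℤP.i≤j⇒i⊓k≤j _ (ℤP.i⊓j≤j (b false false) (b false true))
min₂≤ b true  false = ℤP.i≤j⇒k⊓i≤j _ (ℤP.i⊓j≤i (b true false) (b true true))
min₂≤ b true  true  = ℤP.i≤j⇒k⊓i≤j _ (ℤP.i⊓j≤j (b true false) (b true true))

range1-nonneg : ∀ u → 0ℤ ≤ range1 u
range1-nonneg u = ℤP.i≤j⇒0≤j-i (ℤP.≤-trans (min₁≤ u false) (≤max₁ u false))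

entry-difference-bound : ∀ b z w z′ w′ → ∣ b z w - b z′ w′ ∣≤ range2 b
entry-difference-bound b z w z′ w′ =
  ∣-∣≤-width (min₂≤ b z w) (≤max₂ b z w) (min₂≤ b z′ w′) (≤max₂ b z′ w′)

slope : (Bool → ℤ) → ℤ
slope u = u true - u false

slope₁ slope₂ interaction : (Bool → Bool → ℤ) → ℤ
slope₁ b = b true false - b false false
slope₂ b = b false true - b false false
interaction b = b true true - b true false - b false true + b false false

slope-bound : ∀ u → ∣ slope u ∣≤ range1 u
slope-bound u = ∣-∣≤-width (min₁≤ u true) (≤max₁ u true) (min₁≤ u false) (≤max₁ u false)

interaction-bound : ∀ b → ∣ interaction b ∣≤ range2 b + range2 b
interaction-bound b =
  subst (λ t → ∣ t ∣≤ range2 b + range2 b) (sym (regroup (b false false) (b true false) (b false true) (b true true)))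
    (+-closed ∣∣≤-additive (entry-difference-bound b true true true false)
                           (entry-difference-bound b false false false true))
  where
  regroup : ∀ p q r t → t - q - r + p ≡ (t - q) + (p - r)
  regroup = solve-∀

unary-decomposition : ∀ (u : Bool → ℤ) z → u z ≡ u false + z · slope u
unary-decomposition u false = sym (ℤP.+-identityʳ _)
unary-decomposition u true  = expand (u false) (u true)
  where
  expand : ∀ p q → q ≡ p + (q - p)
  expand = solve-∀

binary-decomposition : ∀ (b : Bool → Bool → ℤ) z w →
  b z w ≡ (b false false + (z · slope₁ b + w · slope₂ b)) + (z ∧ w) · interaction b
binary-decomposition b false false = expand (b false false)
  where
  expand : ∀ p → p ≡ (p + (0ℤ + 0ℤ)) + 0ℤ
  expand = solve-∀
binary-decomposition b false true = expand (b false false) (b false true)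
  where
  expand : ∀ p r → r ≡ (p + (0ℤ + (r - p))) + 0ℤ
  expand = solve-∀
binary-decomposition b true false = expand (b false false) (b true false)
  where
  expand : ∀ p q → q ≡ (p + ((q - p) + 0ℤ)) + 0ℤ
  expand = solve-∀
binary-decomposition b true true = expand (b false false) (b true false) (b false true) (b true true)
  where
  expand : ∀ p q r t → t ≡ (p + ((q - p) + (r - p))) + (t - q - r + p)
  expand = solve-∀

simpleBinary : ℤ → Bool → Bool → ℤ
simpleBinary q z w = (z ∧ w) · q

range2-simpleBinary : ∀ q → range2 (simpleBinary q) ≡ spread q
range2-simpleBinary q = cong₂ _-_
  (trans (cong (_⊔ (0ℤ ⊔ q)) (ℤP.⊔-idem 0ℤ))
    (trans (sym (ℤP.⊔-assoc 0ℤ 0ℤ q)) (cong (_⊔ q) (ℤP.⊔-idem 0ℤ))))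
  (trans (cong (_⊓ (0ℤ ⊓ q)) (ℤP.⊓-idem 0ℤ))
    (trans (sym (ℤP.⊓-assoc 0ℤ 0ℤ q)) (cong (_⊓ q) (ℤP.⊓-idem 0ℤ))))

range0-zero : (m : Maybe ℤ) → opt range0 m ≡ 0ℤ
range0-zero nothing  = refl
range0-zero (just c) = ℤP.+-inverseʳ c

s+4x≤4[s+x] : ∀ s x → 0ℤ ≤ s → 0ℤ + (s + (x + x)) + (x + x) ≤ + 4 * (0ℤ + s + x)
s+4x≤4[s+x] s x 0≤s = ℤP.≤-trans (ℤP.≤-reflexive (sym (ℤP.+-identityʳ _)))
  (ℤP.≤-trans (ℤP.+-monoʳ-≤ (0ℤ + (s + (x + x)) + (x + x)) (ℤP.+-mono-≤ (ℤP.+-mono-≤ 0≤s 0≤s) 0≤s))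
              (ℤP.≤-reflexive (expand s x)))
  where
  expand : ∀ s x → 0ℤ + (s + (x + x)) + (x + x) + (s + s + s) ≡ + 4 * (0ℤ + s + x)
  expand = solve-∀

module Simplification {n : ℕ} (C : Instance n) where
  U : Fin n → Maybe (Bool → ℤ)
  U = unary C

  B : (i j : Fin n) → toℕ i ℕ.< toℕ j → Maybe (Bool → Bool → ℤ)
  B = binary C

  incidentSlopes : Fin n → ℤ
  incidentSlopes i = sumPairs n λ k l p →
    opt (λ b → single k (slope₁ b) i + single l (slope₂ b) i) (B k l p)

  coefficient : Fin n → ℤ
  coefficient i = opt slope (U i) + incidentSlopes i

  constantPart unaryOffsets binaryOffsets constant : ℤ
  constantPart  = opt (λ c → c) (const C)
  unaryOffsets  = sumFin n (λ i → opt (λ u → u false) (U i))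
  binaryOffsets = sumPairs n (λ i j p → opt (λ b → b false false) (B i j p))
  constant      = constantPart + unaryOffsets + binaryOffsets

  simplified : Instance n
  simplified = record
    { const  = just constant
    ; unary  = λ i → just (λ z → z · coefficient i)
    ; binary = λ i j p → Maybe.map (λ b → simpleBinary (interaction b)) (B i j p)
    }

  simplified-simple : Simple simplified
  simplified-simple = record
    { unary-simple  = λ i → refl
    ; binary-simple = λ i j p → simple (B i j p)
    }
    where
    simple : (m : Maybe (Bool → Bool → ℤ)) →
      SimpleBinary (Maybe.map (λ b → simpleBinary (interaction b)) m)
    simple nothing  = tt
    simple (just b) = refl , refl , refl

  module _ (x : Assignment n) where
    linearUnary linearBinary quadratic : ℤ
    linearUnary  = sumFin n (λ i → opt (λ u → x i · slope u) (U i))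
    linearBinary = sumPairs n (λ i j p → opt (λ b → x i · slope₁ b + x j · slope₂ b) (B i j p))
    quadratic    = sumPairs n (λ i j p → opt (λ b → (x i ∧ x j) · interaction b) (B i j p))

    unary-eval : sumFin n (λ i → opt (λ u → u (x i)) (U i)) ≡ unaryOffsets + linearUnary
    unary-eval = trans
      (sumFin-cong n λ i → trans (opt-cong (λ u → unary-decomposition u (x i)) (U i)) (opt-+ _ _ (U i)))
      (sumFin-+ n _ _)

    binary-eval : sumPairs n (λ i j p → opt (λ b → b (x i) (x j)) (B i j p))
                ≡ binaryOffsets + linearBinary + quadratic
    binary-eval = trans
      (sumPairs-cong n λ i j p → trans (opt-cong (λ b → binary-decomposition b (x i) (x j)) (B i j p))
        (trans (opt-+ _ _ (B i j p)) (cong₂ _+_ (opt-+ _ _ (B i j p)) refl)))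
      (trans (sumPairs-+ n _ _) (cong₂ _+_ (sumPairs-+ n _ _) refl))

    incidentSlopes-eval : sumFin n (λ i → x i · incidentSlopes i) ≡ linearBinary
    incidentSlopes-eval = trans
      (sumFin-cong n λ i → trans (·-sumPairs (x i) n _) (sumPairs-cong n λ k l p →
        trans (·-opt (x i) _ (B k l p)) (opt-cong (λ b → trans (·-distrib-+ (x i) _ _)
          (cong₂ _+_ (·-single x k i _) (·-single x l i _))) (B k l p))))
      (sumFin-endpoints n B (λ k l p b → x k · slope₁ b) (λ k l p b → x l · slope₂ b))

    simplified-eval : eval simplified x ≡ constant + (linearUnary + linearBinary) + quadratic
    simplified-eval = cong₂ _+_ (cong (_+_ constant)
        (trans (sumFin-cong n λ i → trans (·-distrib-+ (x i) _ _) (cong₂ _+_ (·-opt (x i) slope (U i)) refl))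
               (trans (sumFin-+ n _ _) (cong (_+_ linearUnary) incidentSlopes-eval))))
      (sumPairs-cong n λ i j p → opt-map _ _ (B i j p))

    simplified-equivalent : eval simplified x ≡ eval C x
    simplified-equivalent = trans simplified-eval (trans
      (regroup constantPart unaryOffsets binaryOffsets linearUnary linearBinary quadratic)
      (sym (cong₂ _+_ (cong (_+_ constantPart) unary-eval) binary-eval)))
      where
      regroup : ∀ c e₁ e₂ l₁ l₂ q → (c + e₁ + e₂) + (l₁ + l₂) + q ≡ c + (e₁ + l₁) + (e₂ + l₂ + q)
      regroup = solve-∀

  newUnarySpan newBinarySpan : ℤ
  newUnarySpan  = sumFin n (λ i → spread (coefficient i))
  newBinarySpan = sumPairs n (λ i j p → opt range2 (binary simplified i j p))

  unarySpan binarySpan : ℤ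
  unarySpan  = sumFin n (λ i → opt range1 (U i))
  binarySpan = sumPairs n (λ i j p → opt range2 (B i j p))

  unarySpan-nonneg : 0ℤ ≤ unarySpan
  unarySpan-nonneg = sumFin-nonneg n λ i → opt-nonneg (U i)
    where
    opt-nonneg : (m : Maybe (Bool → ℤ)) → 0ℤ ≤ opt range1 m
    opt-nonneg nothing  = ℤP.≤-refl
    opt-nonneg (just u) = range1-nonneg u

  coefficient-bound : ∀ i → ∣ coefficient i ∣≤ opt range1 (U i) + sumPairs n (λ k l p →
    opt (λ b → single k (range2 b) i + single l (range2 b) i) (B k l p))
  coefficient-bound i = +-closed ∣∣≤-additive (opt-preserves ∣∣≤-additive slope-bound (U i))
    (sumPairs-preserves ∣∣≤-additive n λ k l p → opt-preserves ∣∣≤-additive (λ b →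
      +-closed ∣∣≤-additive
        (single-preserves ∣∣≤-additive k i (entry-difference-bound b true false false false))
        (single-preserves ∣∣≤-additive l i (entry-difference-bound b false true false false)))
      (B k l p))

  unary-span-bound : newUnarySpan ≤ unarySpan + (binarySpan + binarySpan)
  unary-span-bound = ℤP.≤-trans
    (sumFin-preserves ≤-additive n λ i → spread-≤ (coefficient-bound i))
    (ℤP.≤-reflexive (trans (sumFin-+ n _ _) (cong (_+_ unarySpan)
      (trans (sumFin-endpoints n B (λ _ _ _ → range2) (λ _ _ _ → range2))
             (trans (sumPairs-cong n λ k l p → opt-+ range2 range2 (B k l p)) (sumPairs-+ n _ _))))))

  binary-span-bound : newBinarySpan ≤ binarySpan + binarySpan
  binary-span-bound = ℤP.≤-trans
    (sumPairs-preserves ≤-additive n λ i j p →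
      ℤP.≤-trans (ℤP.≤-reflexive (opt-map range2 _ (B i j p)))
        (opt-preserves ≤-additive (λ b → subst (_≤ range2 b + range2 b)
          (sym (range2-simpleBinary (interaction b))) (spread-≤ (interaction-bound b))) (B i j p)))
    (ℤP.≤-reflexive (trans (sumPairs-cong n λ i j p → opt-+ range2 range2 (B i j p)) (sumPairs-+ n _ _)))

  simplified-span : span simplified ≤ + 4 * span C
  simplified-span = begin
    span simplified
      ≡⟨ cong (λ t → t + newUnarySpan + newBinarySpan) (ℤP.+-inverseʳ constant) ⟩
    0ℤ + newUnarySpan + newBinarySpan
      ≤⟨ ℤP.+-mono-≤ (ℤP.+-monoʳ-≤ 0ℤ unary-span-bound) binary-span-bound ⟩
    0ℤ + (unarySpan + (binarySpan + binarySpan)) + (binarySpan + binarySpan)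
      ≤⟨ s+4x≤4[s+x] unarySpan binarySpan unarySpan-nonneg ⟩
    + 4 * (0ℤ + unarySpan + binarySpan)
      ≡⟨ cong (λ t → + 4 * (t + unarySpan + binarySpan)) (sym (range0-zero (const C))) ⟩
    + 4 * span C ∎
    where open ℤP.≤-Reasoning

proposition6 : (n : ℕ) (C′ : Instance n) →
    Σ (Instance n) (λ C →
      Simple C × MagnitudeEquivalent C C′ × span C ≤ + 4 * span C′)
proposition6 n C′ = simplified , simplified-simple , simplified-equivalent , simplified-span
  where open Simplification C′
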